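{- Let $D$ be the clause gadget graph (defined in the context) and let $U_i = \{a_4^i, a_5^i, a_6^i\} \subseteq V(D)$ for $i \in \{1,2,3\}$. Then for every set of indices $I \subseteq \{1,2,3\}$, the graph $D - \bigcup_{i \in I} U_i$ (obtained by deleting these vertices) has a perfect triangle tiling if and only if $\lvert I\rvert=2$.
   Context: Let $W$ be the graph on vertices $a_1,\dots,a_6$ consisting of the cycle $a_1a_2a_3a_4a_5a_6a_1$ together with the chords $a_1a_5$, $a_2a_4$, $a_2a_5$. Take three vertex-disjoint copies $W^1,W^2,W^3$ of $W$, where $a_i^j$ denotes the copy of $a_i$ in $W^j$. The graph $D$ is obtained from $W^1,W^2,W^3$ by identifying $a_1^j$ with $a_3^{j+1}$ for each $j\in\{1,2,3\}$ and adding the edges $a_2^ja_2^{j+1}$ for each $j\in\{1,2,3\}$, where superscript $4$ means $1$. A perfect triangle tiling of a graph is a family of pairwise vertex-disjoint triangles covering all its vertices. -}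

module Defs where

open import Data.Fin using (Fin; zero; suc)
open import Data.Fin.Subset using (Subset; _∈_; ∣_∣)
open import Data.Sum using (_⊎_)
open import Data.Product using (_×_; _,_; ∃-syntax; Σ-syntax)
open import Data.List using (List; []; _∷_; concatMap)
open import Data.List.Relation.Unary.All using (All)
open import Data.List.Relation.Unary.Unique.Propositional using (Unique)
import Data.List.Membership.Propositional as LM
open import Relation.Binary.PropositionalEquality using (_≡_)
open import Relation.Nullary using (¬_)

-- Superscript j ∈ {1,2,3} is Fin 3 (zero ↦ 1); subscript i ∈ {1..6} is Fin 6 (zero ↦ 1).
next : Fin 3 → Fin 3
next zero = suc zero
next (suc zero) = suc (suc zero)
next (suc (suc zero)) = zero

-- Vertices of D: since a_1^j is identified with a_3^{j+1}, every vertex is uniquely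
-- a_{k+2}^j for j : Fin 3, k : Fin 5.  So V(D) = Fin 3 × Fin 5 (15 vertices).
V : Set
V = Fin 3 × Fin 5

-- a j i  is the vertex a_i^j of D  (after identification).
a : Fin 3 → Fin 6 → V
a j zero = next j , suc zero          -- a_1^j = a_3^{j+1}
a j (suc k) = j , k                    -- a_{k+2}^j

data WEdge : Fin 6 → Fin 6 → Set where
  e12 : WEdge zero (suc zero)
  e23 : WEdge (suc zero) (suc (suc zero))
  e34 : WEdge (suc (suc zero)) (suc (suc (suc zero)))
  e45 : WEdge (suc (suc (suc zero))) (suc (suc (suc (suc zero))))
  e56 : WEdge (suc (suc (suc (suc zero)))) (suc (suc (suc (suc (suc zero)))))
  e61 : WEdge (suc (suc (suc (suc (suc zero))))) zero
  e15 : WEdge zero (suc (suc (suc (suc zero))))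
  e24 : WEdge (suc zero) (suc (suc (suc zero)))
  e25 : WEdge (suc zero) (suc (suc (suc (suc zero))))

data Adj : V → V → Set where
  copy     : ∀ j {x y} → WEdge x y → Adj (a j x) (a j y)
  copy-sym : ∀ j {x y} → WEdge x y → Adj (a j y) (a j x)
  link     : ∀ j → Adj (a j (suc zero)) (a (next j) (suc zero))
  link-sym : ∀ j → Adj (a (next j) (suc zero)) (a j (suc zero))

InU : Fin 3 → V → Set
InU i v = ∃[ k ] ((k ≡ suc (suc (suc zero)) ⊎ k ≡ suc (suc (suc (suc zero))) ⊎ k ≡ suc (suc (suc (suc (suc zero)))))
                   × v ≡ a i k)

Deleted : Subset 3 → V → Set
Deleted I v = ∃[ i ] (i ∈ I × InU i v)

Triangle : Set
Triangle = V × V × V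

verts : Triangle → List V
verts (x , y , z) = x ∷ y ∷ z ∷ []

IsTriangleIn : (V → Set) → Triangle → Set
IsTriangleIn Del (x , y , z) =
  Adj x y × Adj y z × Adj x z × ¬ Del x × ¬ Del y × ¬ Del z

PerfectTriangleTiling : (V → Set) → Set
PerfectTriangleTiling Del =
  Σ[ T ∈ List Triangle ]
    (All (IsTriangleIn Del) T
     × Unique (concatMap verts T)
     × (∀ v → ¬ Del v → v LM.∈ concatMap verts T))

{-# OPTIONS --safe #-}
module Submission where

-- A tile through v consists of v and two distinct surviving neighbours of v, and tiles
-- sharing a vertex coincide.
--  * If U_i and U_{i+1} both survive (as they do for some i when |I| ≤ 1): the only
--    neighbours of a₆^i are a₅^i and a₁^i, so its tile is {a₁^i, a₅^i, a₆^i}, and likewise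
--    for i+1.  The neighbours of a₄^{i+1} are a₂^{i+1}, a₃^{i+1} = a₁^i and a₅^{i+1}, so its
--    tile meets, hence equals, one of those two tiles; but a₄ is adjacent to no a₆.
--  * If every U_i is deleted, the surviving neighbours of a₁^i = a₃^{i+1} are a₂^i and
--    a₂^{i+1}, so the tiles of a₁^1 and a₁^3 both contain a₂^1 and coincide, although no
--    two a₃'s are adjacent.
--  * If only U_m survives, {a₂, a₃, a₄}^m, {a₁, a₅, a₆}^m and {a₁^{m+1}, a₂^{m+1}, a₂^{m+2}}
--    tile what is left.

open import Function.Base using (_∘_; const)
open import Function.Bundles using (_⇔_; mk⇔)
open import Relation.Binary.PropositionalEquality using (_≡_; _≢_; refl; sym; cong; module ≡-Reasoning)
open import Relation.Nullary using (¬_)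
open import Relation.Nullary.Decidable using (from-yes)
open import Data.Empty using (⊥-elim)
open import Data.Product using (_×_; _,_; ∃-syntax; ∃₂; proj₁; proj₂)
open import Data.Product.Properties using (≡-dec)
open import Data.Sum using (_⊎_; inj₁; inj₂; [_,_])
open import Data.Fin using (Fin; zero; suc)
open import Data.Fin.Properties using (_≟_)
open import Data.Fin.Subset using (Subset; ∣_∣; inside; outside; ⊤; ⁅_⁆; ∁) renaming (_∈_ to _∈ₛ_; _∉_ to _∉ₛ_)
open import Data.Fin.Subset.Properties using (∈⊤; x∈⁅x⁆; x∈⁅y⁆⇒x≡y; x∈p⇒x∉∁p; x∉∁p⇒x∈p)
open import Data.Vec using ([]; _∷_)
import Data.Vec as Vec
open import Data.List using (List; []; _∷_; _++_; concatMap)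
open import Data.List.Membership.Propositional using (_∈_; find; lose)
open import Data.List.Membership.Propositional.Properties using (∈-concatMap⁺; ∈-concatMap⁻)
open import Data.List.Relation.Binary.Disjoint.Propositional using (Disjoint)
open import Data.List.Relation.Unary.All as All using (All; []; _∷_)
open import Data.List.Relation.Unary.All.Properties using (++⁻ˡ; ++⁻ʳ)
open import Data.List.Relation.Unary.AllPairs using ([]; _∷_)
open import Data.List.Relation.Unary.Any using (here; there)
open import Data.List.Relation.Unary.Unique.Propositional using (Unique)
open import Data.List.Relation.Unary.Unique.DecPropositional (≡-dec (_≟_ {3}) (_≟_ {5})) using (unique?)

open import Defs

pattern 1st = here refl
pattern 2nd = there (here refl)
pattern 3rd = there (there (here refl))

module _ {a} {A : Set a} where

  Unique-++⁻ˡ : ∀ xs {ys : List A} → Unique (xs ++ ys) → Unique xs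
  Unique-++⁻ˡ [] _ = []
  Unique-++⁻ˡ (_ ∷ xs) (x∉ ∷ u) = ++⁻ˡ xs x∉ ∷ Unique-++⁻ˡ xs u

  Unique-++⁻ʳ : ∀ xs {ys : List A} → Unique (xs ++ ys) → Unique ys
  Unique-++⁻ʳ [] u = u
  Unique-++⁻ʳ (_ ∷ xs) (_ ∷ u) = Unique-++⁻ʳ xs u

  Unique-++⇒Disjoint : ∀ xs {ys : List A} → Unique (xs ++ ys) → Disjoint xs ys
  Unique-++⇒Disjoint (_ ∷ xs) (x∉ ∷ _) (1st , x∈ys) = All.lookup (++⁻ʳ xs x∉) x∈ys refl
  Unique-++⇒Disjoint (_ ∷ xs) (_ ∷ u) (there v∈xs , v∈ys) = Unique-++⇒Disjoint xs u (v∈xs , v∈ys)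

module _ {a b} {A : Set a} {B : Set b} (f : A → List B) where

  ∈-concatMap⁺′ : ∀ {x xs y} → x ∈ xs → y ∈ f x → y ∈ concatMap f xs
  ∈-concatMap⁺′ x∈xs y∈fx = ∈-concatMap⁺ f (lose x∈xs y∈fx)

  Unique-concatMap⁻ : ∀ {xs x} → Unique (concatMap f xs) → x ∈ xs → Unique (f x)
  Unique-concatMap⁻ {x ∷ _} u 1st = Unique-++⁻ˡ (f x) u
  Unique-concatMap⁻ {x ∷ _} u (there x∈xs) = Unique-concatMap⁻ (Unique-++⁻ʳ (f x) u) x∈xs

  Unique-concatMap⇒≡ : ∀ {xs x₁ x₂ y} → Unique (concatMap f xs) →
                       x₁ ∈ xs → x₂ ∈ xs → y ∈ f x₁ → y ∈ f x₂ → x₁ ≡ x₂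
  Unique-concatMap⇒≡ u 1st 1st _ _ = refl
  Unique-concatMap⇒≡ {x ∷ _} u 1st (there x₂∈xs) y∈fx y∈fx₂ =
    ⊥-elim (Unique-++⇒Disjoint (f x) u (y∈fx , ∈-concatMap⁺′ x₂∈xs y∈fx₂))
  Unique-concatMap⇒≡ {x ∷ _} u (there x₁∈xs) 1st y∈fx₁ y∈fx =
    ⊥-elim (Unique-++⇒Disjoint (f x) u (y∈fx , ∈-concatMap⁺′ x₁∈xs y∈fx₁))
  Unique-concatMap⇒≡ {x ∷ _} u (there x₁∈xs) (there x₂∈xs) =
    Unique-concatMap⇒≡ (Unique-++⁻ʳ (f x) u) x₁∈xs x₂∈xs

next³≡id : ∀ j → next (next (next j)) ≡ j
next³≡id zero = refl
next³≡id (suc zero) = refl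
next³≡id (suc (suc zero)) = refl

next-injective : ∀ {i j} → next i ≡ next j → i ≡ j
next-injective {i} {j} eq = begin
  i                     ≡⟨ sym (next³≡id i) ⟩
  next (next (next i))  ≡⟨ cong (next ∘ next) eq ⟩
  next (next (next j))  ≡⟨ next³≡id j ⟩
  j                     ∎
  where open ≡-Reasoning

orbit : ∀ m j → j ≡ m ⊎ j ≡ next m ⊎ j ≡ next (next m)
orbit zero zero = inj₁ refl
orbit zero (suc zero) = inj₂ (inj₁ refl)
orbit zero (suc (suc zero)) = inj₂ (inj₂ refl)
orbit (suc zero) zero = inj₂ (inj₂ refl)
orbit (suc zero) (suc zero) = inj₁ refl
orbit (suc zero) (suc (suc zero)) = inj₂ (inj₁ refl)
orbit (suc (suc zero)) zero = inj₂ (inj₁ refl)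
orbit (suc (suc zero)) (suc zero) = inj₂ (inj₂ refl)
orbit (suc (suc zero)) (suc (suc zero)) = inj₁ refl

a₁ a₂ a₃ a₄ a₅ a₆ : Fin 3 → V
a₁ j = a j zero
a₂ j = a j (suc zero)
a₃ j = a j (suc (suc zero))
a₄ j = a j (suc (suc (suc zero)))
a₅ j = a j (suc (suc (suc (suc zero))))
a₆ j = a j (suc (suc (suc (suc (suc zero)))))

Adj-sym : ∀ {u w} → Adj u w → Adj w u
Adj-sym (copy j e) = copy-sym j e
Adj-sym (copy-sym j e) = copy j e
Adj-sym (link j) = link-sym j
Adj-sym (link-sym j) = link j

-- Stated for u ≡ a₃ j rather than for Adj (a₃ j) w, as matching Adj against an index of
-- the form a j x gets stuck.  The third case is a₃^j seen as a₁^i.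
a₃-neighbours : ∀ {u w j} → Adj u w → u ≡ a₃ j →
                w ≡ a₂ j ⊎ w ≡ a₄ j ⊎ ∃[ i ] (next i ≡ j × (w ≡ a₂ i ⊎ w ≡ a₅ i ⊎ w ≡ a₆ i))
a₃-neighbours (copy-sym _ e23) refl = inj₁ refl
a₃-neighbours (copy _ e34) refl = inj₂ (inj₁ refl)
a₃-neighbours (copy i e12) refl = inj₂ (inj₂ (i , refl , inj₁ refl))
a₃-neighbours (copy i e15) refl = inj₂ (inj₂ (i , refl , inj₂ (inj₁ refl)))
a₃-neighbours (copy-sym i e61) refl = inj₂ (inj₂ (i , refl , inj₂ (inj₂ refl)))

a₄-neighbours : ∀ {u w j} → Adj u w → u ≡ a₄ j → w ≡ a₂ j ⊎ w ≡ a₃ j ⊎ w ≡ a₅ j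
a₄-neighbours (copy-sym _ e24) refl = inj₁ refl
a₄-neighbours (copy-sym _ e34) refl = inj₂ (inj₁ refl)
a₄-neighbours (copy _ e45) refl = inj₂ (inj₂ refl)

a₆-neighbours : ∀ {u w j} → Adj u w → u ≡ a₆ j → w ≡ a₅ j ⊎ w ≡ a₁ j
a₆-neighbours (copy _ e61) refl = inj₂ refl
a₆-neighbours (copy-sym _ e56) refl = inj₁ refl

a₃-independent : ∀ {i j} → ¬ Adj (a₃ i) (a₃ j)
a₃-independent adj with a₃-neighbours adj refl
... | inj₁ ()
... | inj₂ (inj₁ ())
... | inj₂ (inj₂ (_ , _ , inj₁ ()))
... | inj₂ (inj₂ (_ , _ , inj₂ (inj₁ ())))
... | inj₂ (inj₂ (_ , _ , inj₂ (inj₂ ())))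

a₄≁a₆ : ∀ {i j} → ¬ Adj (a₄ i) (a₆ j)
a₄≁a₆ adj with a₆-neighbours (Adj-sym adj) refl
... | inj₁ ()
... | inj₂ ()

Deleted⇒∈U : ∀ {I j k} → Deleted I (j , k) → j ∈ₛ I × ∃[ l ] k ≡ suc (suc l)
Deleted⇒∈U (_ , i∈I , _ , inj₁ refl , refl) = i∈I , _ , refl
Deleted⇒∈U (_ , i∈I , _ , inj₂ (inj₁ refl) , refl) = i∈I , _ , refl
Deleted⇒∈U (_ , i∈I , _ , inj₂ (inj₂ refl) , refl) = i∈I , _ , refl

∈U⇒Deleted : ∀ {I j l} → j ∈ₛ I → Deleted I (j , suc (suc l))
∈U⇒Deleted {l = zero} j∈I = _ , j∈I , _ , inj₁ refl , refl
∈U⇒Deleted {l = suc zero} j∈I = _ , j∈I , _ , inj₂ (inj₁ refl) , refl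
∈U⇒Deleted {l = suc (suc zero)} j∈I = _ , j∈I , _ , inj₂ (inj₂ refl) , refl

∉⇒kept : ∀ {I j k} → j ∉ₛ I → ¬ Deleted I (j , k)
∉⇒kept j∉I = j∉I ∘ proj₁ ∘ Deleted⇒∈U

a₂-kept : ∀ {I j} → ¬ Deleted I (a₂ j)
a₂-kept d with Deleted⇒∈U d
... | _ , _ , ()

a₃-kept : ∀ {I j} → ¬ Deleted I (a₃ j)
a₃-kept d with Deleted⇒∈U d
... | _ , _ , ()

a₁-neighbours-outside-U : ∀ {i w} → Adj (a₁ i) w → ¬ Deleted ⊤ w → w ≡ a₂ i ⊎ w ≡ a₂ (next i)
a₁-neighbours-outside-U adj w-kept with a₃-neighbours adj refl
... | inj₁ refl = inj₂ refl
... | inj₂ (inj₁ refl) = ⊥-elim (w-kept (∈U⇒Deleted ∈⊤))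
... | inj₂ (inj₂ (_ , eq , inj₁ refl)) = inj₁ (cong a₂ (next-injective eq))
... | inj₂ (inj₂ (_ , _ , inj₂ (inj₁ refl))) = ⊥-elim (w-kept (∈U⇒Deleted ∈⊤))
... | inj₂ (inj₂ (_ , _ , inj₂ (inj₂ refl))) = ⊥-elim (w-kept (∈U⇒Deleted ∈⊤))

triangle-≡⊎Adj : ∀ {Del t v w} → IsTriangleIn Del t → v ∈ verts t → w ∈ verts t → v ≡ w ⊎ Adj v w
triangle-≡⊎Adj _                1st 1st = inj₁ refl
triangle-≡⊎Adj (xy , _)         1st 2nd = inj₂ xy
triangle-≡⊎Adj (_ , _ , xz , _) 1st 3rd = inj₂ xz
triangle-≡⊎Adj (xy , _)         2nd 1st = inj₂ (Adj-sym xy)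
triangle-≡⊎Adj _                2nd 2nd = inj₁ refl
triangle-≡⊎Adj (_ , yz , _)     2nd 3rd = inj₂ yz
triangle-≡⊎Adj (_ , _ , xz , _) 3rd 1st = inj₂ (Adj-sym xz)
triangle-≡⊎Adj (_ , yz , _)     3rd 2nd = inj₂ (Adj-sym yz)
triangle-≡⊎Adj _                3rd 3rd = inj₁ refl

TrianglePartner : (V → Set) → Triangle → V → V → Set
TrianglePartner Del t v p = Adj v p × ¬ Del p × p ∈ verts t

triangle-partners : ∀ {Del t v} → IsTriangleIn Del t → Unique (verts t) → v ∈ verts t →
                    ∃₂ λ p q → p ≢ q × TrianglePartner Del t v p × TrianglePartner Del t v q
triangle-partners (xy , yz , xz , _ , ¬y , ¬z) (_ ∷ (y≢z ∷ []) ∷ _) 1st =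
  _ , _ , y≢z , (xy , ¬y , 2nd) , (xz , ¬z , 3rd)
triangle-partners (xy , yz , xz , ¬x , _ , ¬z) ((_ ∷ x≢z ∷ []) ∷ _) 2nd =
  _ , _ , x≢z , (Adj-sym xy , ¬x , 1st) , (yz , ¬z , 3rd)
triangle-partners (xy , yz , xz , ¬x , ¬y , _) ((x≢y ∷ _) ∷ _) 3rd =
  _ , _ , x≢y , (Adj-sym xz , ¬x , 1st) , (Adj-sym yz , ¬y , 2nd)

module Tiling {Del : V → Set} (T : List Triangle) (triangles : All (IsTriangleIn Del) T)
              (disjoint : Unique (concatMap verts T)) (covering : ∀ v → ¬ Del v → v ∈ concatMap verts T) where

  SameTile : V → V → Set
  SameTile v w = ∃[ t ] (t ∈ T × v ∈ verts t × w ∈ verts t)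

  SameTile-sym : ∀ {v w} → SameTile v w → SameTile w v
  SameTile-sym (t , t∈T , v∈t , w∈t) = t , t∈T , w∈t , v∈t

  SameTile-trans : ∀ {u v w} → SameTile u v → SameTile v w → SameTile u w
  SameTile-trans (t , t∈T , u∈t , v∈t) (s , s∈T , v∈s , w∈s)
    with Unique-concatMap⇒≡ verts disjoint t∈T s∈T v∈t v∈s
  ... | refl = t , t∈T , u∈t , w∈s

  apart : ∀ {v w} → v ≢ w → ¬ Adj v w → ¬ SameTile v w
  apart v≢w v≁w (t , t∈T , v∈t , w∈t) =
    [ v≢w , v≁w ] (triangle-≡⊎Adj {Del} (All.lookup triangles t∈T) v∈t w∈t)

  TilePartner : V → V → Set
  TilePartner v p = Adj v p × ¬ Del p × SameTile v p

  tile-partners : ∀ {v} → ¬ Del v → ∃₂ λ p q → p ≢ q × TilePartner v p × TilePartner v q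
  tile-partners v-kept with find (∈-concatMap⁻ verts (covering _ v-kept))
  ... | t , t∈T , v∈t
    with triangle-partners (All.lookup triangles t∈T) (Unique-concatMap⁻ verts disjoint t∈T) v∈t
  ... | p , q , p≢q , (vp , p-kept , p∈t) , (vq , q-kept , q∈t) =
    p , q , p≢q , (vp , p-kept , t , t∈T , v∈t , p∈t) , (vq , q-kept , t , t∈T , v∈t , q∈t)

  two-partners : ∀ {v x y} → ¬ Del v → (∀ {w} → Adj v w → ¬ Del w → w ≡ x ⊎ w ≡ y) →
                 SameTile v x × SameTile v y
  two-partners v-kept neighbours with tile-partners v-kept
  ... | p , q , p≢q , (vp , p-kept , vp-tiled) , (vq , q-kept , vq-tiled)
    with neighbours vp p-kept | neighbours vq q-kept
  ... | inj₁ refl | inj₂ refl = vp-tiled , vq-tiled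
  ... | inj₂ refl | inj₁ refl = vq-tiled , vp-tiled
  ... | inj₁ refl | inj₁ refl = ⊥-elim (p≢q refl)
  ... | inj₂ refl | inj₂ refl = ⊥-elim (p≢q refl)

  three-partners : ∀ {v x y z} → ¬ Del v → (∀ {w} → Adj v w → ¬ Del w → w ≡ x ⊎ w ≡ y ⊎ w ≡ z) →
                   SameTile v y ⊎ SameTile v z
  three-partners v-kept neighbours with tile-partners v-kept
  ... | p , q , p≢q , (vp , p-kept , vp-tiled) , (vq , q-kept , vq-tiled)
    with neighbours vp p-kept | neighbours vq q-kept
  ... | inj₂ (inj₁ refl) | _ = inj₁ vp-tiled
  ... | inj₂ (inj₂ refl) | _ = inj₂ vp-tiled
  ... | inj₁ refl | inj₂ (inj₁ refl) = inj₁ vq-tiled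
  ... | inj₁ refl | inj₂ (inj₂ refl) = inj₂ vq-tiled
  ... | inj₁ refl | inj₁ refl = ⊥-elim (p≢q refl)

untileable-if-consecutive-kept : ∀ {I} i → i ∉ₛ I → next i ∉ₛ I → ¬ PerfectTriangleTiling (Deleted I)
untileable-if-consecutive-kept i i∉I i⁺∉I (T , triangles , disjoint , covering) =
  [ (λ a₄~a₃ → a₄-a₆-apart (SameTile-trans a₄~a₃ (SameTile-sym a₆~a₁)))
  , (λ a₄~a₅ → a₄-a₆-apart (SameTile-trans a₄~a₅ (SameTile-sym a₆~a₅))) ]
  (three-partners (∉⇒kept i⁺∉I) (λ adj _ → a₄-neighbours adj refl))
  where
  open Tiling T triangles disjoint covering

  a₆~a₁ : SameTile (a₆ i) (a₁ i)
  a₆~a₁ = proj₂ (two-partners (∉⇒kept i∉I) (λ adj _ → a₆-neighbours adj refl))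

  a₆~a₅ : SameTile (a₆ (next i)) (a₅ (next i))
  a₆~a₅ = proj₁ (two-partners (∉⇒kept i⁺∉I) (λ adj _ → a₆-neighbours adj refl))

  a₄-a₆-apart : ∀ {j} → ¬ SameTile (a₄ (next i)) (a₆ j)
  a₄-a₆-apart = apart (λ ()) a₄≁a₆

untileable-all-deleted : ¬ PerfectTriangleTiling (Deleted ⊤)
untileable-all-deleted (T , triangles , disjoint , covering) =
  apart (λ ()) a₃-independent
    (SameTile-trans (proj₁ (a₁-partners zero)) (SameTile-sym (proj₂ (a₁-partners (suc (suc zero))))))
  where
  open Tiling T triangles disjoint covering

  a₁-partners : ∀ i → SameTile (a₁ i) (a₂ i) × SameTile (a₁ i) (a₂ (next i))
  a₁-partners i = two-partners a₃-kept a₁-neighbours-outside-U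

tiles-keeping : Fin 3 → List Triangle
tiles-keeping m = (a₂ m , a₃ m , a₄ m) ∷ (a₁ m , a₅ m , a₆ m)
                ∷ (a₁ (next m) , a₂ (next m) , a₂ (next (next m))) ∷ []

tiles-keeping-disjoint : ∀ m → Unique (concatMap verts (tiles-keeping m))
tiles-keeping-disjoint zero = from-yes (unique? (concatMap verts (tiles-keeping zero)))
tiles-keeping-disjoint (suc zero) = from-yes (unique? (concatMap verts (tiles-keeping (suc zero))))
tiles-keeping-disjoint (suc (suc zero)) = from-yes (unique? (concatMap verts (tiles-keeping (suc (suc zero)))))

tiling-keeping : ∀ m → PerfectTriangleTiling (Deleted (∁ ⁅ m ⁆))
tiling-keeping m = tiles-keeping m , triangles , tiles-keeping-disjoint m , covering
  where
  m-kept : ∀ {k} → ¬ Deleted (∁ ⁅ m ⁆) (m , k)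
  m-kept = ∉⇒kept (x∈p⇒x∉∁p (x∈⁅x⁆ m))

  triangles : All (IsTriangleIn (Deleted (∁ ⁅ m ⁆))) (tiles-keeping m)
  triangles = (copy m e23 , copy m e34 , copy m e24 , a₂-kept , a₃-kept , m-kept)
            ∷ (copy m e15 , copy m e56 , copy-sym m e61 , a₃-kept , m-kept , m-kept)
            ∷ (copy (next m) e12 , link (next m) , copy-sym (next (next m)) e23 , a₃-kept , a₂-kept , a₂-kept)
            ∷ []

  in-tiles : ∀ {t v} → t ∈ tiles-keeping m → v ∈ verts t → v ∈ concatMap verts (tiles-keeping m)
  in-tiles = ∈-concatMap⁺′ verts

  covering : ∀ v → ¬ Deleted (∁ ⁅ m ⁆) v → v ∈ concatMap verts (tiles-keeping m)
  covering (j , zero) _ with orbit m j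
  ... | inj₁ refl        = in-tiles 1st 1st
  ... | inj₂ (inj₁ refl) = in-tiles 3rd 2nd
  ... | inj₂ (inj₂ refl) = in-tiles 3rd 3rd
  covering (j , suc zero) _ with orbit m j
  ... | inj₁ refl        = in-tiles 1st 2nd
  ... | inj₂ (inj₁ refl) = in-tiles 2nd 1st
  ... | inj₂ (inj₂ refl) = in-tiles 3rd 1st
  covering (j , suc (suc k)) j-kept with x∈⁅y⁆⇒x≡y m (x∉∁p⇒x∈p (j-kept ∘ ∈U⇒Deleted))
  covering (_ , suc (suc zero)) _ | refl             = in-tiles 1st 3rd
  covering (_ , suc (suc (suc zero))) _ | refl       = in-tiles 2nd 2nd
  covering (_ , suc (suc (suc (suc zero)))) _ | refl = in-tiles 2nd 3rd

lemma5p4 : (I : Subset 3) → PerfectTriangleTiling (Deleted I) ⇔ (∣ I ∣ ≡ 2)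
lemma5p4 (outside ∷ outside ∷ outside ∷ []) =
  mk⇔ (⊥-elim ∘ untileable-if-consecutive-kept zero (λ ()) (λ { (Vec.there ()) })) (λ ())
lemma5p4 (inside ∷ outside ∷ outside ∷ []) =
  mk⇔ (⊥-elim ∘ untileable-if-consecutive-kept (suc zero) (λ { (Vec.there ()) }) (λ { (Vec.there (Vec.there ())) })) (λ ())
lemma5p4 (outside ∷ inside ∷ outside ∷ []) =
  mk⇔ (⊥-elim ∘ untileable-if-consecutive-kept (suc (suc zero)) (λ { (Vec.there (Vec.there ())) }) (λ ())) (λ ())
lemma5p4 (outside ∷ outside ∷ inside ∷ []) =
  mk⇔ (⊥-elim ∘ untileable-if-consecutive-kept zero (λ ()) (λ { (Vec.there ()) })) (λ ())
lemma5p4 (inside ∷ inside ∷ inside ∷ []) =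
  mk⇔ (⊥-elim ∘ untileable-all-deleted) (λ ())
lemma5p4 (outside ∷ inside ∷ inside ∷ []) = mk⇔ (const refl) (const (tiling-keeping zero))
lemma5p4 (inside ∷ outside ∷ inside ∷ []) = mk⇔ (const refl) (const (tiling-keeping (suc zero)))
lemma5p4 (inside ∷ inside ∷ outside ∷ []) = mk⇔ (const refl) (const (tiling-keeping (suc (suc zero))))
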